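{- In the active learning framework without any restriction on the teacher beyond returning tree counterexamples, learning an unknown LPTS is impossible: for every learner (whose conjectures are always consistent with the counterexamples received so far) there is a teacher which never confirms equivalence, such that for every round $n\ge1$ there is an LPTS $U_n$ with the property that the counterexample returned in round $n$ is a valid negative or positive counterexample to the round-$n$ hypothesis $H_n$ with respect to $U_n$, and every counterexample returned in rounds $1,\dots,n$ is consistent with $U_n$ (each positive one is simulated by $U_n$, no negative one is). Consequently no learner is guaranteed to terminate with a hypothesis simulation equivalent to the unknown target.
   Context: All probabilities are rationals. $\mathrm{Dist}(S)$: discrete distributions on $S$. An LPTS is $\langle S,s^0,\alpha,\tau\rangle$, finite $S$, start state $s^0$, finite actions $\alpha$, finite $\tau\subseteq S\times\alpha\times\mathrm{Dist}(S)$; $s\xrightarrow{a}\mu$ means $(s,a,\mu)\in\tau$. A tree is an LPTS whose start state is in the support of no transition distribution and each other state is in the support of exactly one. $\mu_1\sqsubseteq_R\mu_2$ iff there is a weight function $w:S_1\times S_2\to\mathbb{Q}\cap[0,1]$ with row sums $\mu_1$, column sums $\mu_2$ and $w(s_1,s_2)>0\Rightarrow s_1Rs_2$; $R$ is a strong simulation iff $s_1Rs_2$, $s_1\xrightarrow{a}\mu_1$ imply some $s_2\xrightarrow{a}\mu_2$ with $\mu_1\sqsubseteq_R\mu_2$; $L_1\preceq L_2$ iff a strong simulation relates the start states; $L_1\simeq L_2$ iff $L_1\preceq L_2$ and $L_2\preceq L_1$. Active learning framework: there is an unknown target LPTS $U$; a learner and a teacher interact in rounds. In round $n$ the learner conjectures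 a hypothesis LPTS $H_n$. The teacher checks $H_n\simeq U$; if it holds the interaction ends, otherwise it returns a tree counterexample $C$, which is negative if $C\preceq H_n$ and $C\not\preceq U$, and positive if $C\preceq U$ and $C\not\preceq H_n$. The learner accumulates the positive counterexamples in $\mathcal{P}$ and the negative ones in $\mathcal{N}$; each conjecture must be consistent with them (simulate every element of $\mathcal{P}$ and no element of $\mathcal{N}$), and at all times some LPTS must be consistent with all counterexamples returned so far. -}

module Defs where

open import Data.Nat using (ℕ; zero; suc)
open import Data.Fin using (Fin)
open import Data.Rational using (ℚ; 0ℚ; 1ℚ; _+_; _≤_; _<_)
open import Data.List using (List; []; _∷_; _++_; [_])
open import Data.List.Relation.Unary.All using (All)
open import Data.List.Membership.Propositional using (_∈_)
open import Data.Product using (Σ; ∃; ∃-syntax; _×_; _,_; proj₁; proj₂)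
open import Data.Bool using (Bool; true; false)
open import Relation.Nullary using (¬_)
open import Relation.Binary.PropositionalEquality using (_≡_)

sumFin : ∀ {n} → (Fin n → ℚ) → ℚ
sumFin {zero}  f = 0ℚ
sumFin {suc n} f = f Fin.zero + sumFin (λ i → f (Fin.suc i))

IsDist : ∀ {n} → (Fin n → ℚ) → Set
IsDist {n} μ = (∀ i → 0ℚ ≤ μ i) × sumFin μ ≡ 1ℚ

module _ (Act : Set) where

  Trans : ℕ → Set
  Trans n = Fin n × Act × (Fin n → ℚ)

  record LPTS : Set where
    field
      states : ℕ
      start  : Fin states
      trans  : List (Trans states)
      valid  : All (λ t → IsDist (proj₂ (proj₂ t))) trans

  open LPTS public

  Step : (L : LPTS) → Fin (states L) → Act → (Fin (states L) → ℚ) → Set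
  Step L s a μ = (s , a , μ) ∈ trans L

  SameTrans : ∀ {n} → Trans n → Trans n → Set
  SameTrans {n} (s , a , μ) (s' , a' , μ') = s ≡ s' × a ≡ a' × (∀ i → μ i ≡ μ' i)

  InSupport : ∀ {n} → Fin n → Trans n → Set
  InSupport t (s , a , μ) = 0ℚ < μ t

  IsTree : LPTS → Set
  IsTree L =
      (∀ tr → tr ∈ trans L → ¬ InSupport (start L) tr)
    × (∀ t → ¬ (t ≡ start L) →
         (∃[ tr ] (tr ∈ trans L × InSupport t tr))
       × (∀ tr tr' → tr ∈ trans L → tr' ∈ trans L →
            InSupport t tr → InSupport t tr' → SameTrans tr tr'))

  Lift : ∀ {n₁ n₂} → (Fin n₁ → Fin n₂ → Set) →
         (Fin n₁ → ℚ) → (Fin n₂ → ℚ) → Set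
  Lift {n₁} {n₂} R μ₁ μ₂ =
    Σ (Fin n₁ → Fin n₂ → ℚ) λ w → ( (∀ i j → 0ℚ ≤ w i j × w i j ≤ 1ℚ)
           × (∀ i → sumFin (λ j → w i j) ≡ μ₁ i)
           × (∀ j → sumFin (λ i → w i j) ≡ μ₂ j)
           × (∀ i j → 0ℚ < w i j → R i j) )

  IsStrongSim : (L₁ L₂ : LPTS) → (Fin (states L₁) → Fin (states L₂) → Set) → Set
  IsStrongSim L₁ L₂ R =
    ∀ s₁ s₂ a μ₁ → R s₁ s₂ → Step L₁ s₁ a μ₁ →
      ∃[ μ₂ ] (Step L₂ s₂ a μ₂ × Lift R μ₁ μ₂)

  _≼_ : LPTS → LPTS → Set₁
  L₁ ≼ L₂ = ∃[ R ] (IsStrongSim L₁ L₂ R × R (start L₁) (start L₂))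

  _≃ₛ_ : LPTS → LPTS → Set₁
  L₁ ≃ₛ L₂ = (L₁ ≼ L₂) × (L₂ ≼ L₁)

  record CEx : Set where
    constructor cex
    field
      tree     : LPTS
      isTree   : IsTree tree
      positive : Bool

  open CEx public

  ConsistentWith : LPTS → CEx → Set₁
  ConsistentWith H c with positive c
  ... | true  = tree c ≼ H
  ... | false = ¬ (tree c ≼ H)

  Consistent : LPTS → List CEx → Set₁
  Consistent H hist = All (ConsistentWith H) hist

  Satisfiable : List CEx → Set₁
  Satisfiable hist = ∃[ L ] Consistent L hist

  ValidCEx : CEx → LPTS → LPTS → Set₁
  ValidCEx c H U with positive c
  ... | true  = (tree c ≼ U) × ¬ (tree c ≼ H)
  ... | false = (tree c ≼ H) × ¬ (tree c ≼ U)

  record Learner : Set₁ where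
    field
      conj : List CEx → LPTS
      cons : ∀ hist → Satisfiable hist → Consistent (conj hist) hist

  open Learner public

  -- history of the first n counterexamples (rounds 1..n) of a teacher's
  -- answer sequence  c 0 , c 1 , …  (c k = answer in round k+1)
  history : (ℕ → CEx) → ℕ → List CEx
  history c zero    = []
  history c (suc n) = history c n ++ [ c n ]

  hyp : Learner → (ℕ → CEx) → ℕ → LPTS
  hyp 𝓛 c n = conj 𝓛 (history c n)

-- The teacher answers with the four-state trees  probe p  (0 < p < 1): an a-step from the
-- root reaches, with probability p, a state that can do a again, and a dead state otherwise.
-- An LPTS L simulates probe p exactly when the start state of L has an a-step putting mass
-- at least p on states that can do a; in particular probe p ≼ probe q iff p ≤ q.
-- The teacher maintains an interval [lo , hi) of values q for which probe q is consistent
-- with every counterexample so far and bisects it at a midpoint m: probe m is returned as a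
-- negative counterexample if the hypothesis simulates it and as a positive one otherwise.
-- Either way the answer is valid for the target probe lo of the new interval, which is also
-- consistent with all earlier answers, and the interval never becomes empty.
module Submission where

open import Defs hiding (_≼_; positive)
open import Data.Bool using (Bool; true; false; if_then_else_)
open import Data.Nat using (ℕ; zero; suc)
open import Data.Fin using (Fin) renaming (zero to f0; suc to fs)
open import Data.Fin.Properties using (_≟_)
open import Data.Rational
  using (ℚ; 0ℚ; 1ℚ; _+_; _*_; _-_; -_; 1/_; _÷_; _≤_; _<_; NonZero; Positive; positive; nonNegative)
open import Data.Rational.Properties hiding (_≟_)
open import Data.Rational.Solver using (module +-*-Solver)
open import Data.List using (List; []; _∷_; _++_; [_])
open import Data.List.Relation.Unary.All as All using (All; []; _∷_)
open import Data.List.Relation.Unary.All.Properties using (++⁺)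
open import Data.List.Relation.Unary.Any using (Any; here; there; any?)
open import Data.List.Membership.Propositional using (_∈_; find; lose)
open import Data.Product using (∃-syntax; _×_; _,_; proj₁; proj₂)
open import Data.Unit using (⊤; tt)
open import Data.Empty using (⊥-elim)
open import Relation.Nullary using (¬_; Dec; yes; no; does)
open import Relation.Nullary.Decidable using (map′; _×-dec_)
open import Relation.Binary.Definitions using (DecidableEquality)
open import Relation.Binary.PropositionalEquality
  using (_≡_; refl; sym; cong; cong₂; subst; module ≡-Reasoning)
  renaming (trans to ≡-trans)

open +-*-Solver

0ℚ<1ℚ : 0ℚ < 1ℚ
0ℚ<1ℚ = positive⁻¹ 1ℚ

p≤q⇒0≤q-p : ∀ {p q} → p ≤ q → 0ℚ ≤ q - p
p≤q⇒0≤q-p {p} {q} p≤q = subst (_≤ q - p) (+-inverseʳ p) (+-monoˡ-≤ (- p) p≤q)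

p<q⇒0<q-p : ∀ {p q} → p < q → 0ℚ < q - p
p<q⇒0<q-p {p} {q} p<q = subst (_< q - p) (+-inverseʳ p) (+-monoˡ-< (- p) p<q)

0≤p⇒q-p≤q : ∀ {p q} → 0ℚ ≤ p → q - p ≤ q
0≤p⇒q-p≤q {p} {q} 0≤p = subst (q - p ≤_) (+-identityʳ q) (+-monoʳ-≤ q (neg-antimono-≤ 0≤p))

*-≤-self : ∀ {p q} → 0ℚ ≤ p → q ≤ 1ℚ → p * q ≤ p
*-≤-self {p} {q} 0≤p q≤1 =
  subst (p * q ≤_) (*-identityʳ p) (*-monoˡ-≤-nonNeg p {{nonNegative 0≤p}} q≤1)

*-nonNeg : ∀ {p q} → 0ℚ ≤ p → 0ℚ ≤ q → 0ℚ ≤ p * q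
*-nonNeg {p} {q} 0≤p 0≤q =
  nonNegative⁻¹ (p * q) {{nonNeg*nonNeg⇒nonNeg p {{nonNegative 0≤p}} q {{nonNegative 0≤q}}}}

module _ {q : ℚ} (0<q : 0ℚ < q) where

  private instance
    q-positive : Positive q
    q-positive = positive 0<q
    q≢0 : NonZero q
    q≢0 = pos⇒nonZero q

  ÷-nonNeg : ∀ {p} → 0ℚ ≤ p → 0ℚ ≤ p ÷ q
  ÷-nonNeg 0≤p = *-nonNeg 0≤p (<⇒≤ (positive⁻¹ (1/ q) {{1/pos⇒pos q}}))

  p≤q⇒p÷q≤1 : ∀ {p} → p ≤ q → p ÷ q ≤ 1ℚ
  p≤q⇒p÷q≤1 {p} p≤q = subst (p ÷ q ≤_) (*-inverseʳ q)
    (*-monoʳ-≤-nonNeg (1/ q) {{pos⇒nonNeg (1/ q) {{1/pos⇒pos q}}}} p≤q)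

*-÷-cancel : ∀ p q .{{_ : NonZero q}} → q * (p ÷ q) ≡ p
*-÷-cancel p q = begin
  q * (p * 1/ q)   ≡⟨ cong (q *_) (*-comm p (1/ q)) ⟩
  q * (1/ q * p)   ≡⟨ *-assoc q (1/ q) p ⟨
  q * 1/ q * p     ≡⟨ cong (_* p) (*-inverseʳ q) ⟩
  1ℚ * p           ≡⟨ *-identityˡ p ⟩
  p                ∎
  where open ≡-Reasoning

sumFin-0 : ∀ {n} → sumFin {n} (λ _ → 0ℚ) ≡ 0ℚ
sumFin-0 {zero}  = refl
sumFin-0 {suc n} = cong (0ℚ +_) (sumFin-0 {n})

sumFin-mono : ∀ {n} {f g : Fin n → ℚ} → (∀ i → f i ≤ g i) → sumFin f ≤ sumFin g
sumFin-mono {zero}  f≤g = ≤-refl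
sumFin-mono {suc n} f≤g = +-mono-≤ (f≤g f0) (sumFin-mono (λ i → f≤g (fs i)))

sumFin-nonNeg : ∀ {n} {f : Fin n → ℚ} → (∀ i → 0ℚ ≤ f i) → 0ℚ ≤ sumFin f
sumFin-nonNeg {n} {f} 0≤f = subst (_≤ sumFin f) (sumFin-0 {n}) (sumFin-mono 0≤f)

≤-sumFin : ∀ {n} {f : Fin n → ℚ} → (∀ i → 0ℚ ≤ f i) → ∀ i → f i ≤ sumFin f
≤-sumFin {suc n} {f} 0≤f f0 =
  subst (_≤ sumFin f) (+-identityʳ (f f0)) (+-monoʳ-≤ (f f0) (sumFin-nonNeg (λ i → 0≤f (fs i))))
≤-sumFin {suc n} {f} 0≤f (fs i) =
  ≤-trans (≤-sumFin (λ i → 0≤f (fs i)) i)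
          (subst (_≤ sumFin f) (+-identityˡ (sumFin (λ i → f (fs i)))) (+-monoˡ-≤ _ (0≤f f0)))

sumFin-*ʳ : ∀ {n} (f : Fin n → ℚ) t → sumFin (λ i → f i * t) ≡ sumFin f * t
sumFin-*ʳ {zero}  f t = sym (*-zeroˡ t)
sumFin-*ʳ {suc n} f t =
  ≡-trans (cong (f f0 * t +_) (sumFin-*ʳ (λ i → f (fs i)) t)) (sym (*-distribʳ-+ t (f f0) _))

sumFin-- : ∀ {n} (f g : Fin n → ℚ) → sumFin (λ i → f i - g i) ≡ sumFin f - sumFin g
sumFin-- {zero}  f g = refl
sumFin-- {suc n} f g =
  ≡-trans (cong (f f0 - g f0 +_) (sumFin-- (λ i → f (fs i)) (λ i → g (fs i))))
          (solve 4 (λ a b c d → (a :- b) :+ (c :- d) := (a :+ c) :- (b :+ d)) refl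
                 (f f0) (g f0) (sumFin (λ i → f (fs i))) (sumFin (λ i → g (fs i))))

IsDist⇒≤1 : ∀ {n} {μ : Fin n → ℚ} → IsDist μ → ∀ i → μ i ≤ 1ℚ
IsDist⇒≤1 {μ = μ} (0≤μ , sum≡1) i = subst (μ i ≤_) sum≡1 (≤-sumFin 0≤μ i)

infix 7 _when_

_when_ : ∀ {P : Set} → ℚ → Dec P → ℚ
x when P? = if does P? then x else 0ℚ

when-nonNeg : ∀ {P : Set} {x} (P? : Dec P) → 0ℚ ≤ x → 0ℚ ≤ x when P?
when-nonNeg (yes _) 0≤x = 0≤x
when-nonNeg (no _)  0≤x = ≤-refl

when-≤ : ∀ {P : Set} {x} (P? : Dec P) → 0ℚ ≤ x → x when P? ≤ x
when-≤ (yes _) 0≤x = ≤-refl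
when-≤ (no _)  0≤x = 0≤x

when-yes : ∀ {P : Set} {x} (P? : Dec P) → P → x when P? ≡ x
when-yes (yes _) _ = refl
when-yes (no ¬p) p = ⊥-elim (¬p p)

when-no : ∀ {P : Set} {x} (P? : Dec P) → ¬ P → x when P? ≡ 0ℚ
when-no (yes p) ¬p = ⊥-elim (¬p p)
when-no (no _)  ¬p = refl

0ℚ-when : ∀ {P : Set} (P? : Dec P) → 0ℚ when P? ≡ 0ℚ
0ℚ-when (yes _) = refl
0ℚ-when (no _)  = refl

sumFin-when-≟ : ∀ {n} (i : Fin n) x → sumFin (λ k → x when (i ≟ k)) ≡ x
sumFin-when-≟ {suc n} f0     x = ≡-trans (cong (x +_) (sumFin-0 {n})) (+-identityʳ x)
sumFin-when-≟ {suc n} (fs i) x = ≡-trans (+-identityˡ _) (sumFin-when-≟ i x)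

pointMass : ∀ {n} → Fin n → Fin n → ℚ
pointMass i k = 1ℚ when (i ≟ k)

pointMass-isDist : ∀ {n} (i : Fin n) → IsDist (pointMass i)
pointMass-isDist i = (λ k → when-nonNeg (i ≟ k) (<⇒≤ 0ℚ<1ℚ)) , sumFin-when-≟ i 1ℚ

module Simulation (Act : Set) where

  infix 4 _≼_

  _≼_ : LPTS Act → LPTS Act → Set₁
  _≼_ = Defs._≼_ Act

  Lift-pointMass : ∀ {m n} {R : Fin m → Fin n → Set} {μ : Fin n → ℚ} (i : Fin m) →
                   (∀ s → R i s) → IsDist μ → Lift Act R (pointMass i) μ
  Lift-pointMass {m} {n} {R} {μ} i R-i μ-dist = w , bounds , rows , cols , support
    where
    w : Fin m → Fin n → ℚ
    w k s = μ s when (i ≟ k)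
    bounds : ∀ k s → 0ℚ ≤ w k s × w k s ≤ 1ℚ
    bounds k s = when-nonNeg (i ≟ k) (proj₁ μ-dist s)
               , ≤-trans (when-≤ (i ≟ k) (proj₁ μ-dist s)) (IsDist⇒≤1 μ-dist s)
    rows : ∀ k → sumFin (w k) ≡ pointMass i k
    rows k with i ≟ k
    ... | yes _ = proj₂ μ-dist
    ... | no _  = sumFin-0 {n}
    cols : ∀ s → sumFin (λ k → w k s) ≡ μ s
    cols s = sumFin-when-≟ i (μ s)
    support : ∀ k s → 0ℚ < w k s → R k s
    support k s 0<w with i ≟ k
    ... | yes refl = R-i s
    ... | no _     = ⊥-elim (<-irrefl refl 0<w)

  stepSuchThat? : DecidableEquality Act → (L : LPTS Act) (s : Fin (states L)) (b : Act)
                  {P : (Fin (states L) → ℚ) → Set} → (∀ μ → Dec (P μ)) →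
                  Dec (∃[ μ ] (Step Act L s b μ × P μ))
  stepSuchThat? _≟ₐ_ L s b {P} P? = map′ fromAny toAny (any? matches? (trans L))
    where
    Matches : Trans Act (states L) → Set
    Matches (s′ , b′ , μ) = s′ ≡ s × b′ ≡ b × P μ
    matches? : ∀ t → Dec (Matches t)
    matches? (s′ , b′ , μ) = s′ ≟ s ×-dec b′ ≟ₐ b ×-dec P? μ
    fromAny : Any Matches (trans L) → ∃[ μ ] (Step Act L s b μ × P μ)
    fromAny m with find m
    ... | (_ , _ , μ) , t∈ , (refl , refl , Pμ) = μ , t∈ , Pμ
    toAny : ∃[ μ ] (Step Act L s b μ × P μ) → Any Matches (trans L)
    toAny (μ , t∈ , Pμ) = lose t∈ (refl , refl , Pμ)

module Probe (Act : Set) (_≟ₐ_ : DecidableEquality Act) (a : Act) where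

  open Simulation Act

  pattern root = f0
  pattern live = fs f0
  pattern dead = fs (fs f0)
  pattern leaf = fs (fs (fs f0))

  branch : ℚ → Fin 4 → ℚ
  branch p root = 0ℚ
  branch p live = p
  branch p dead = 1ℚ - p
  branch p leaf = 0ℚ

  branch-isDist : ∀ {p} → 0ℚ ≤ p → p ≤ 1ℚ → IsDist (branch p)
  branch-isDist {p} 0≤p p≤1 = nonNeg , sum≡1
    where
    nonNeg : ∀ i → 0ℚ ≤ branch p i
    nonNeg root = ≤-refl
    nonNeg live = 0≤p
    nonNeg dead = p≤q⇒0≤q-p p≤1
    nonNeg leaf = ≤-refl
    sum≡1 : sumFin (branch p) ≡ 1ℚ
    sum≡1 = solve 1 (λ p → con 0ℚ :+ (p :+ ((con 1ℚ :- p) :+ (con 0ℚ :+ con 0ℚ))) := con 1ℚ) refl p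

  probeTrans : ℚ → List (Trans Act 4)
  probeTrans p = (root , a , branch p) ∷ (live , a , pointMass leaf) ∷ []

  probe : (p : ℚ) → 0ℚ ≤ p → p ≤ 1ℚ → LPTS Act
  probe p 0≤p p≤1 = record
    { states = 4
    ; start  = root
    ; trans  = probeTrans p
    ; valid  = branch-isDist 0≤p p≤1 ∷ pointMass-isDist leaf ∷ []
    }

  probe-isTree : ∀ {p 0≤p p≤1} → 0ℚ < p → p < 1ℚ → IsTree Act (probe p 0≤p p≤1)
  probe-isTree {p} 0<p p<1 = root-unreached , λ s s≢root → reached s s≢root , unique s
    where
    root-unreached : ∀ t → t ∈ probeTrans p → ¬ InSupport Act root t
    root-unreached _ (here refl)         = <-irrefl refl
    root-unreached _ (there (here refl)) = <-irrefl refl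
    disjoint : ∀ s → 0ℚ < branch p s → ¬ 0ℚ < pointMass leaf s
    disjoint root 0<0 = ⊥-elim (<-irrefl refl 0<0)
    disjoint live _   = <-irrefl refl
    disjoint dead _   = <-irrefl refl
    disjoint leaf 0<0 = ⊥-elim (<-irrefl refl 0<0)
    unique : ∀ s t t′ → t ∈ probeTrans p → t′ ∈ probeTrans p →
             InSupport Act s t → InSupport Act s t′ → SameTrans Act t t′
    unique s _ _ (here refl)         (here refl)         _ _  = refl , refl , λ _ → refl
    unique s _ _ (there (here refl)) (there (here refl)) _ _  = refl , refl , λ _ → refl
    unique s _ _ (here refl)         (there (here refl)) in₁ in₂ = ⊥-elim (disjoint s in₁ in₂)
    unique s _ _ (there (here refl)) (here refl)         in₁ in₂ = ⊥-elim (disjoint s in₂ in₁)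
    reached : ∀ s → ¬ s ≡ root → ∃[ t ] (t ∈ probeTrans p × InSupport Act s t)
    reached root s≢root = ⊥-elim (s≢root refl)
    reached live _      = _ , here refl , 0<p
    reached dead _      = _ , here refl , p<q⇒0<q-p p<1
    reached leaf _      = _ , there (here refl) , 0ℚ<1ℚ

  Enabled : (L : LPTS Act) → Fin (states L) → Set
  Enabled L s = ∃[ μ ] Step Act L s a μ

  enabled? : (L : LPTS Act) (s : Fin (states L)) → Dec (Enabled L s)
  enabled? L s = map′ (λ (μ , s→μ , _) → μ , s→μ) (λ (μ , s→μ) → μ , s→μ , tt)
                      (stepSuchThat? _≟ₐ_ L s a {λ _ → ⊤} (λ _ → yes tt))

  enabledMass : (L : LPTS Act) → (Fin (states L) → ℚ) → ℚ
  enabledMass L μ = sumFin (λ s → μ s when enabled? L s)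

  HeavyStart : LPTS Act → ℚ → Set
  HeavyStart L p = ∃[ μ ] (Step Act L (start L) a μ × p ≤ enabledMass L μ)

  probe-≼⇒heavyStart : ∀ {p 0≤p p≤1 L} → probe p 0≤p p≤1 ≼ L → HeavyStart L p
  probe-≼⇒heavyStart {p} {L = L} (R , sim , root-R-start)
    with sim root (start L) a (branch p) root-R-start (here refl)
  ... | μ , start→μ , (w , bounds , rows , cols , support) =
    μ , start→μ , subst (_≤ enabledMass L μ) (rows live) (sumFin-mono w-live≤)
    where
    -- mass coupled to live sits on states simulating live, and these are enabled
    w-live≤ : ∀ s → w live s ≤ μ s when enabled? L s
    w-live≤ s = bound (enabled? L s)
      where
      bound : (s? : Dec (Enabled L s)) → w live s ≤ μ s when s?
      bound (yes _) = subst (w live s ≤_) (cols s) (≤-sumFin (λ i → proj₁ (bounds i s)) live)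
      bound (no s-disabled) = ≮⇒≥ λ 0<w →
        let ν , s→ν , _ = sim live s a (pointMass leaf) (support live s 0<w) (there (here refl))
        in s-disabled (ν , s→ν)

  probeRel : (L : LPTS Act) → Fin 4 → Fin (states L) → Set
  probeRel L root s = s ≡ start L
  probeRel L live s = Enabled L s
  probeRel L dead _ = ⊤
  probeRel L leaf _ = ⊤

  -- live takes the fraction p / enabledMass L μ of the mass of every enabled state,
  -- dead takes all the rest.
  branch-⊑ : ∀ {p L μ} → IsDist μ → 0ℚ < p → p ≤ enabledMass L μ →
             Lift Act (probeRel L) (branch p) μ
  branch-⊑ {p} {L} {μ} μ-dist 0<p p≤M = w , bounds , rows , cols , support
    where
    M : ℚ
    M = enabledMass L μ
    0<M : 0ℚ < M
    0<M = <-≤-trans 0<p p≤M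
    instance
      M≢0 : NonZero M
      M≢0 = pos⇒nonZero M {{positive 0<M}}
    e : Fin (states L) → ℚ
    e s = μ s when enabled? L s
    t : ℚ
    t = p ÷ M
    0≤t : 0ℚ ≤ t
    0≤t = ÷-nonNeg 0<M (<⇒≤ 0<p)
    0≤e : ∀ s → 0ℚ ≤ e s
    0≤e s = when-nonNeg (enabled? L s) (proj₁ μ-dist s)
    et≤μ : ∀ s → e s * t ≤ μ s
    et≤μ s = ≤-trans (*-≤-self (0≤e s) (p≤q⇒p÷q≤1 0<M p≤M))
                     (when-≤ (enabled? L s) (proj₁ μ-dist s))
    w : Fin 4 → Fin (states L) → ℚ
    w live s = e s * t
    w dead s = μ s - e s * t
    w _    s = 0ℚ
    bounds : ∀ i s → 0ℚ ≤ w i s × w i s ≤ 1ℚ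
    bounds root s = ≤-refl , <⇒≤ 0ℚ<1ℚ
    bounds live s = *-nonNeg (0≤e s) 0≤t , ≤-trans (et≤μ s) (IsDist⇒≤1 μ-dist s)
    bounds dead s = p≤q⇒0≤q-p (et≤μ s)
                  , ≤-trans (0≤p⇒q-p≤q (*-nonNeg (0≤e s) 0≤t)) (IsDist⇒≤1 μ-dist s)
    bounds leaf s = ≤-refl , <⇒≤ 0ℚ<1ℚ
    live-row : sumFin (w live) ≡ p
    live-row = ≡-trans (sumFin-*ʳ e t) (*-÷-cancel p M)
    rows : ∀ i → sumFin (w i) ≡ branch p i
    rows root = sumFin-0 {states L}
    rows live = live-row
    rows dead = ≡-trans (sumFin-- μ (w live)) (cong₂ _-_ (proj₂ μ-dist) live-row)
    rows leaf = sumFin-0 {states L}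
    cols : ∀ s → sumFin (λ i → w i s) ≡ μ s
    cols s = solve 2 (λ x y → con 0ℚ :+ (y :+ ((x :- y) :+ (con 0ℚ :+ con 0ℚ))) := x) refl
                     (μ s) (e s * t)
    live-support : ∀ {s} (s? : Dec (Enabled L s)) → 0ℚ < (μ s when s?) * t → Enabled L s
    live-support (yes s-enabled) _ = s-enabled
    live-support (no _) 0<0*t      = ⊥-elim (<-irrefl refl (subst (0ℚ <_) (*-zeroˡ t) 0<0*t))
    support : ∀ i s → 0ℚ < w i s → probeRel L i s
    support root s 0<0 = ⊥-elim (<-irrefl refl 0<0)
    support live s 0<w = live-support (enabled? L s) 0<w
    support dead s _   = tt
    support leaf s _   = tt

  heavyStart⇒probe-≼ : ∀ {p 0≤p p≤1 L} → 0ℚ < p → HeavyStart L p → probe p 0≤p p≤1 ≼ L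
  heavyStart⇒probe-≼ {p} {0≤p} {p≤1} {L} 0<p (μ , start→μ , p≤M) = probeRel L , simulation , refl
    where
    simulation : IsStrongSim Act (probe p 0≤p p≤1) L (probeRel L)
    simulation root _ _ _ refl (here refl) =
      μ , start→μ , branch-⊑ (All.lookup (valid L) start→μ) 0<p p≤M
    simulation live _ _ _ (ν , s→ν) (there (here refl)) =
      ν , s→ν , Lift-pointMass leaf (λ _ → tt) (All.lookup (valid L) s→ν)
    simulation _    _ _ _ _ (there (there ()))
    simulation root _ _ _ _ (there (here ()))
    simulation live _ _ _ _ (here ())
    simulation dead _ _ _ _ (here ())
    simulation dead _ _ _ _ (there (here ()))
    simulation leaf _ _ _ _ (here ())
    simulation leaf _ _ _ _ (there (here ()))

  probe-≼? : ∀ {p 0≤p p≤1} L → 0ℚ < p → Dec (probe p 0≤p p≤1 ≼ L)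
  probe-≼? {p} {0≤p} {p≤1} L 0<p =
    map′ (heavyStart⇒probe-≼ {p} {0≤p} {p≤1} {L} 0<p) (probe-≼⇒heavyStart {p} {0≤p} {p≤1} {L})
    (stepSuchThat? _≟ₐ_ L (start L) a (λ μ → p ≤? enabledMass L μ))

  enabledMass-branch : ∀ {q 0≤q q≤1} → enabledMass (probe q 0≤q q≤1) (branch q) ≡ q
  enabledMass-branch {q} {0≤q} {q≤1} = begin
    0ℚ when enabled? P root + (q when enabled? P live
      + ((1ℚ - q) when enabled? P dead + (0ℚ when enabled? P leaf + 0ℚ)))
      ≡⟨ cong₂ _+_ (0ℚ-when (enabled? P root))
           (cong₂ _+_ (when-yes {x = q} (enabled? P live) (_ , there (here refl)))
             (cong₂ _+_ (when-no {x = 1ℚ - q} (enabled? P dead) dead-disabled)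
               (cong (_+ 0ℚ) (0ℚ-when (enabled? P leaf))))) ⟩
    0ℚ + (q + (0ℚ + (0ℚ + 0ℚ)))
      ≡⟨ solve 1 (λ q → con 0ℚ :+ (q :+ (con 0ℚ :+ (con 0ℚ :+ con 0ℚ))) := q) refl q ⟩
    q ∎
    where
    open ≡-Reasoning
    P : LPTS Act
    P = probe q 0≤q q≤1
    dead-disabled : ¬ Enabled P dead
    dead-disabled (_ , there (there ()))

  probe-mono : ∀ {p q 0≤p p≤1 0≤q q≤1} → 0ℚ < p → p ≤ q → probe p 0≤p p≤1 ≼ probe q 0≤q q≤1
  probe-mono {p} {q} {0≤p} {p≤1} {0≤q} {q≤1} 0<p p≤q =
    heavyStart⇒probe-≼ {p} {0≤p} {p≤1} {probe q 0≤q q≤1} 0<p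
      (_ , here refl , subst (p ≤_) (sym (enabledMass-branch {q} {0≤q} {q≤1})) p≤q)

  probe-≼⇒≤ : ∀ {p q 0≤p p≤1 0≤q q≤1} → probe p 0≤p p≤1 ≼ probe q 0≤q q≤1 → p ≤ q
  probe-≼⇒≤ {p} {q} {0≤p} {p≤1} {0≤q} {q≤1} p≼q
    with probe-≼⇒heavyStart {p} {0≤p} {p≤1} {probe q 0≤q q≤1} p≼q
  ... | _ , here refl , p≤M = subst (p ≤_) (enabledMass-branch {q} {0≤q} {q≤1}) p≤M
  ... | _ , there (there ()) , _

module Teacher (Act : Set) (_≟ₐ_ : DecidableEquality Act) (a : Act) (𝓛 : Learner Act) where

  open Simulation Act
  open Probe Act _≟ₐ_ a

  record Round : Set where
    field
      lo hi    : ℚ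
      0≤lo     : 0ℚ ≤ lo
      lo<hi    : lo < hi
      hi≤1     : hi ≤ 1ℚ
      received : List (CEx Act)

    lo≤1 : lo ≤ 1ℚ
    lo≤1 = <⇒≤ (<-≤-trans lo<hi hi≤1)

    mid : ℚ
    mid = proj₁ (<-dense lo<hi)

    lo<mid : lo < mid
    lo<mid = proj₁ (proj₂ (<-dense lo<hi))

    mid<hi : mid < hi
    mid<hi = proj₂ (proj₂ (<-dense lo<hi))

    0<mid : 0ℚ < mid
    0<mid = ≤-<-trans 0≤lo lo<mid

    mid<1 : mid < 1ℚ
    mid<1 = <-≤-trans mid<hi hi≤1

    0≤mid : 0ℚ ≤ mid
    0≤mid = <⇒≤ 0<mid

    mid≤1 : mid ≤ 1ℚ
    mid≤1 = <⇒≤ mid<1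

    target : LPTS Act
    target = probe lo 0≤lo lo≤1

    query : LPTS Act
    query = probe mid 0≤mid mid≤1

    query-≼ : ∀ q (0≤q : 0ℚ ≤ q) (q≤1 : q ≤ 1ℚ) → mid ≤ q → query ≼ probe q 0≤q q≤1
    query-≼ q 0≤q q≤1 = probe-mono {mid} {q} {0≤mid} {mid≤1} {0≤q} {q≤1} 0<mid

    query-⋠ : ∀ q (0≤q : 0ℚ ≤ q) (q≤1 : q ≤ 1ℚ) → q < mid → ¬ query ≼ probe q 0≤q q≤1
    query-⋠ q 0≤q q≤1 q<mid query≼probe = <-irrefl refl (<-≤-trans q<mid
      (probe-≼⇒≤ {mid} {q} {0≤mid} {mid≤1} {0≤q} {q≤1} query≼probe))

    counterexample : Bool → CEx Act
    counterexample = cex query (probe-isTree {mid} {0≤mid} {mid≤1} 0<mid mid<1)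

    hypothesis : LPTS Act
    hypothesis = conj 𝓛 received

    decide : Dec (query ≼ hypothesis)
    decide = probe-≼? {mid} {0≤mid} {mid≤1} hypothesis 0<mid

  open Round

  answer : (r : Round) → Dec (query r ≼ hypothesis r) → CEx Act
  answer r (yes _) = counterexample r false
  answer r (no _)  = counterexample r true

  shrink : (r : Round) → Dec (query r ≼ hypothesis r) → Round
  shrink r (yes _) = record r { hi = mid r ; lo<hi = lo<mid r ; hi≤1 = mid≤1 r }
  shrink r (no _)  = record r { lo = mid r ; 0≤lo = 0≤mid r ; lo<hi = mid<hi r }

  next : (r : Round) → Dec (query r ≼ hypothesis r) → Round
  next r d = record (shrink r d) { received = received r ++ [ answer r d ] }

  initial : Round
  initial = record
    { lo = 0ℚ ; hi = 1ℚ ; 0≤lo = ≤-refl ; lo<hi = 0ℚ<1ℚ ; hi≤1 = ≤-refl ; received = [] }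

  round : ℕ → Round
  round zero    = initial
  round (suc n) = next (round n) (decide (round n))

  answers : ℕ → CEx Act
  answers n = answer (round n) (decide (round n))

  history-answers : ∀ n → history Act answers n ≡ received (round n)
  history-answers zero    = refl
  history-answers (suc n) = cong (_++ [ answers n ]) (history-answers n)

  ConsistentOn : ℚ → ℚ → CEx Act → Set₁
  ConsistentOn lo hi c =
    ∀ q (0≤q : 0ℚ ≤ q) (q≤1 : q ≤ 1ℚ) → lo ≤ q → q < hi →
    ConsistentWith Act (probe q 0≤q q≤1) c

  ConsistentOn-shrink : ∀ {lo hi lo′ hi′} → lo ≤ lo′ → hi′ ≤ hi → ∀ c →
                        ConsistentOn lo hi c → ConsistentOn lo′ hi′ c
  ConsistentOn-shrink lo≤lo′ hi′≤hi c on q 0≤q q≤1 lo′≤q q<hi′ =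
    on q 0≤q q≤1 (≤-trans lo≤lo′ lo′≤q) (<-≤-trans q<hi′ hi′≤hi)

  Invariant : Round → Set₁
  Invariant r = All (ConsistentOn (lo r) (hi r)) (received r)

  next-invariant : ∀ r d → Invariant r → Invariant (next r d)
  next-invariant r (yes _) inv =
    ++⁺ (All.map (λ {c} → ConsistentOn-shrink ≤-refl (<⇒≤ (mid<hi r)) c) inv)
        ((λ q 0≤q q≤1 _ → query-⋠ r q 0≤q q≤1) ∷ [])
  next-invariant r (no _)  inv =
    ++⁺ (All.map (λ {c} → ConsistentOn-shrink (<⇒≤ (lo<mid r)) ≤-refl c) inv)
        ((λ q 0≤q q≤1 mid≤q _ → query-≼ r q 0≤q q≤1 mid≤q) ∷ [])

  round-invariant : ∀ n → Invariant (round n)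
  round-invariant zero    = []
  round-invariant (suc n) = next-invariant (round n) (decide (round n)) (round-invariant n)

  target-consistent : ∀ r → Invariant r → Consistent Act (target r) (received r)
  target-consistent r = All.map (λ on → on (lo r) (0≤lo r) (lo≤1 r) ≤-refl (lo<hi r))

  answer-valid : ∀ r d → ValidCEx Act (answer r d) (hypothesis r) (target (next r d))
  answer-valid r (yes query≼H) = query≼H , query-⋠ r (lo r) (0≤lo r) (lo≤1 r) (lo<mid r)
  answer-valid r (no query⋠H)  = query-≼ r (mid r) (0≤mid r) (mid≤1 r) ≤-refl , query⋠H

theorem4 : (Act : Set) → DecidableEquality Act → Act →
    (𝓛 : Learner Act) →
    ∃[ c ] (∀ (n : ℕ) → ∃[ U ]
    ( ValidCEx Act (c n) (hyp Act 𝓛 c n) U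
    × Consistent Act U (history Act c (suc n)) ))
theorem4 Act _≟ₐ_ a 𝓛 =
  answers , λ n → target (round (suc n)) , answer-is-valid n , target-is-consistent n
  where
  open Teacher Act _≟ₐ_ a 𝓛
  open Round

  answer-is-valid : ∀ n → ValidCEx Act (answers n) (hyp Act 𝓛 answers n) (target (round (suc n)))
  answer-is-valid n =
    subst (λ h → ValidCEx Act (answers n) (conj 𝓛 h) (target (round (suc n))))
          (sym (history-answers n))
          (answer-valid (round n) (decide (round n)))

  target-is-consistent : ∀ n → Consistent Act (target (round (suc n))) (history Act answers (suc n))
  target-is-consistent n =
    subst (Consistent Act (target (round (suc n))))
          (sym (history-answers (suc n)))
          (target-consistent (round (suc n)) (round-invariant (suc n)))
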